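{- Let $\mathbf A$ be a pseudo-Kleene lattice. Then $\mathbf A$ is sp-orthomodular if and only if, for all $x,y\in A$ with $x\leq y$, the elements $\pi_{0_{x,y}}(x)$ and $\pi_{0_{x,y}}(y)$ generate a Boolean subalgebra of $\mathbf{Local}(x,y)$.
   Context: A pseudo-Kleene lattice is an algebra $(A,\land,\lor,{}',0,1)$ with $(A,\land,\lor,0,1)$ a bounded lattice, ${}'$ an antitone involution, and $x\land x'\leq y\lor y'$. It is sp-orthomodular if for all $x,y$: (SP1) $x\leq y$ and $x'\land y=(x\land x')\lor(y\land y')$ imply $y\land(x\lor x')=x\lor(y\land y')$; (SP2) $x\leq y$ implies $(x\land x')\lor(y\land y')=(x'\land y)\land(x'\land y)'$. For $x,y$ set $0_{x,y}=(x\land x')\lor(y\land y')$, $1_{x,y}=(x\lor x')\land(y\lor y')$, and $\pi_u(v)=(v\land(u\lor u'))\lor(u\land u')$. $\mathbf{Local}(x,y)$ is the pseudo-Kleene lattice on $[0_{x,y},1_{x,y}]$ with inherited $\land,\lor,{}'$ and bounds $0_{x,y},1_{x,y}$. A Boolean subalgebra of $\mathbf{Local}(x,y)$ is a distributive subalgebra in which every element $z$ satisfies $z\land z'=0_{x,y}$. -}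

module Defs where

open import Level using (Level; _⊔_; suc)
open import Relation.Binary.Core using (Rel)
open import Algebra.Core using (Op₁; Op₂)
open import Algebra.Lattice.Structures using (IsLattice)
open import Data.Product using (_×_)

record PseudoKleeneLattice (c ℓ : Level) : Set (suc (c ⊔ ℓ)) where
  infixr 7 _∧_
  infixr 6 _∨_
  infix  4 _≈_ _≤_
  field
    Carrier   : Set c
    _≈_       : Rel Carrier ℓ
    _∧_       : Op₂ Carrier
    _∨_       : Op₂ Carrier
    _′        : Op₁ Carrier
    0#        : Carrier
    1#        : Carrier
    isLattice : IsLattice _≈_ _∨_ _∧_

  _≤_ : Rel Carrier ℓ
  x ≤ y = x ∧ y ≈ x

  field
    0-least    : ∀ x → 0# ≤ x
    1-greatest : ∀ x → x ≤ 1#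
    ′-cong     : ∀ {x y} → x ≈ y → x ′ ≈ y ′
    ′-invol    : ∀ x → (x ′) ′ ≈ x
    ′-antitone : ∀ {x y} → x ≤ y → y ′ ≤ x ′
    kleene     : ∀ x y → x ∧ x ′ ≤ y ∨ y ′

  open IsLattice isLattice public

module _ {c ℓ : Level} (A : PseudoKleeneLattice c ℓ) where
  open PseudoKleeneLattice A

  0[_,_] : Carrier → Carrier → Carrier
  0[ x , y ] = (x ∧ x ′) ∨ (y ∧ y ′)

  1[_,_] : Carrier → Carrier → Carrier
  1[ x , y ] = (x ∨ x ′) ∧ (y ∨ y ′)

  π : Carrier → Carrier → Carrier
  π u v = (v ∧ (u ∨ u ′)) ∨ (u ∧ u ′)

  SP1 : Set (c ⊔ ℓ)
  SP1 = ∀ x y → x ≤ y → x ′ ∧ y ≈ 0[ x , y ] → y ∧ (x ∨ x ′) ≈ x ∨ (y ∧ y ′)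

  SP2 : Set (c ⊔ ℓ)
  SP2 = ∀ x y → x ≤ y → 0[ x , y ] ≈ (x ′ ∧ y) ∧ (x ′ ∧ y) ′

  SpOrthomodular : Set (c ⊔ ℓ)
  SpOrthomodular = SP1 × SP2

  -- A subset S of A (as a predicate) is a Boolean subalgebra of Local(x,y):
  -- S is contained in the interval [0_{x,y}, 1_{x,y}], contains the bounds
  -- 0_{x,y}, 1_{x,y}, is closed under ∧, ∨, ′ (so it is a subalgebra of
  -- Local(x,y)), is distributive, and z ∧ z′ = 0_{x,y} for all z ∈ S.
  record IsBooleanSubalgebraOfLocal (x y : Carrier) (S : Carrier → Set (c ⊔ ℓ)) : Set (c ⊔ ℓ) where
    field
      inInterval : ∀ {z} → S z → (0[ x , y ] ≤ z) × (z ≤ 1[ x , y ])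
      has-0      : S 0[ x , y ]
      has-1      : S 1[ x , y ]
      ∧-closed   : ∀ {z w} → S z → S w → S (z ∧ w)
      ∨-closed   : ∀ {z w} → S z → S w → S (z ∨ w)
      ′-closed   : ∀ {z} → S z → S (z ′)
      distrib    : ∀ {z w v} → S z → S w → S v → z ∧ (w ∨ v) ≈ (z ∧ w) ∨ (z ∧ v)
      complement : ∀ {z} → S z → z ∧ z ′ ≈ 0[ x , y ]

  data Generated (x y a b : Carrier) : Carrier → Set (c ⊔ ℓ) where
    gen-a : Generated x y a b a
    gen-b : Generated x y a b b
    gen-0 : Generated x y a b 0[ x , y ]
    gen-1 : Generated x y a b 1[ x , y ]
    gen-∧ : ∀ {z w} → Generated x y a b z → Generated x y a b w → Generated x y a b (z ∧ w)
    gen-∨ : ∀ {z w} → Generated x y a b z → Generated x y a b w → Generated x y a b (z ∨ w)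
    gen-′ : ∀ {z} → Generated x y a b z → Generated x y a b (z ′)

  GenerateBooleanSubalgebra : (x y a b : Carrier) → Set (c ⊔ ℓ)
  GenerateBooleanSubalgebra x y a b = IsBooleanSubalgebraOfLocal x y (Generated x y a b)

{-# OPTIONS --safe #-}
-- Write u = 0_{x,y}, a = π_u(x), b = π_u(y) and w = a′ ∧ b.  For x ≤ y these are
-- a = x ∨ (y ∧ y′), b = (x ∨ x′) ∧ y and w = x′ ∧ y, all in [u, u′] with u′ = 1_{x,y}.
-- If A is sp-orthomodular, SP2 makes a, b, w sharp (z ∧ z′ = u) and SP1 then gives the
-- orthomodular law b = a ∨ (a′ ∧ b) for sharp a ≤ b.  Hence a, w and b′ split u′ into
-- three pairwise complementary blocks, and the subalgebra generated by a and b is the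
-- image of the Boolean algebra 2³ under (s₁, s₂, s₃) ↦ a^{s₁} ∨ w^{s₂} ∨ b′^{s₃}.
-- Conversely, SP2 is the sharpness of w = x′ ∧ y in that subalgebra, and SP1 follows
-- from y ∧ (x ∨ x′) = b = b ∧ (a ∨ a′) = (b ∧ a) ∨ (b ∧ a′) = a ∨ (x′ ∧ y) by distributivity.
module Submission where

open import Defs
open import Level using (Level)
open import Function.Bundles using (_⇔_; mk⇔)
open import Data.Bool using (Bool; true; false; if_then_else_) renaming (_∨_ to _or_)
open import Data.Product using (_×_; _,_; proj₂; Σ-syntax)
open import Relation.Binary.PropositionalEquality using (_≡_; cong)
open import Algebra.Bundles using (CommutativeSemigroup)
open import Algebra.Lattice.Bundles using (Lattice)
open import Algebra.Structures using (IsCommutativeBand)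
import Algebra.Lattice.Properties.Lattice as LatticeProperties
import Algebra.Properties.CommutativeSemigroup as CommutativeSemigroupProperties
import Relation.Binary.Lattice as OrderLattice
import Relation.Binary.Reasoning.Setoid as SetoidReasoning

module Bool³ where
  open import Data.Bool using (_∧_; _∨_; not)
  open import Data.Bool.Properties using (∧-distribˡ-∨; ∧-inverseʳ)
  open import Relation.Binary.PropositionalEquality using (refl; cong₂)

  Bool³ : Set
  Bool³ = Bool × Bool × Bool

  infixr 7 _∧³_
  infixr 6 _∨³_

  _∧³_ : Bool³ → Bool³ → Bool³
  (s₁ , s₂ , s₃) ∧³ (t₁ , t₂ , t₃) = s₁ ∧ t₁ , s₂ ∧ t₂ , s₃ ∧ t₃

  _∨³_ : Bool³ → Bool³ → Bool³
  (s₁ , s₂ , s₃) ∨³ (t₁ , t₂ , t₃) = s₁ ∨ t₁ , s₂ ∨ t₂ , s₃ ∨ t₃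

  not³ : Bool³ → Bool³
  not³ (s₁ , s₂ , s₃) = not s₁ , not s₂ , not s₃

  false³ true³ : Bool³
  false³ = false , false , false
  true³  = true , true , true

  private
    deMorgan : ∀ s t → not (not s ∨ not t) ≡ s ∧ t
    deMorgan true  true  = refl
    deMorgan true  false = refl
    deMorgan false t     = refl

  ∧³-distribˡ-∨³ : ∀ p q r → p ∧³ (q ∨³ r) ≡ (p ∧³ q) ∨³ (p ∧³ r)
  ∧³-distribˡ-∨³ (s₁ , s₂ , s₃) (t₁ , t₂ , t₃) (r₁ , r₂ , r₃) =
    cong₂ _,_ (∧-distribˡ-∨ s₁ t₁ r₁) (cong₂ _,_ (∧-distribˡ-∨ s₂ t₂ r₂) (∧-distribˡ-∨ s₃ t₃ r₃))

  ∧³-inverseʳ : ∀ p → p ∧³ not³ p ≡ false³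
  ∧³-inverseʳ (s₁ , s₂ , s₃) = cong₂ _,_ (∧-inverseʳ s₁) (cong₂ _,_ (∧-inverseʳ s₂) (∧-inverseʳ s₃))

  not³-deMorgan : ∀ p q → not³ (not³ p ∨³ not³ q) ≡ p ∧³ q
  not³-deMorgan (s₁ , s₂ , s₃) (t₁ , t₂ , t₃) =
    cong₂ _,_ (deMorgan s₁ t₁) (cong₂ _,_ (deMorgan s₂ t₂) (deMorgan s₃ t₃))

open Bool³

module _ {c ℓ : Level} (A : PseudoKleeneLattice c ℓ) where
  open PseudoKleeneLattice A

  lattice : Lattice c ℓ
  lattice = record { isLattice = isLattice }

  open SetoidReasoning (Lattice.setoid lattice)

  open LatticeProperties lattice using (∨-idem; ∨-isSemilattice; ∨-∧-isOrderTheoreticLattice)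

  -- The library orders a lattice by x ≈ x ∧ y, the symmetric form of _≤_.
  private module Ord = OrderLattice.IsLattice ∨-∧-isOrderTheoreticLattice

  ≤-refl : ∀ {x} → x ≤ x
  ≤-refl = sym Ord.refl

  ≤-reflexive : ∀ {x y} → x ≈ y → x ≤ y
  ≤-reflexive x≈y = sym (Ord.reflexive x≈y)

  ≤-trans : ∀ {x y z} → x ≤ y → y ≤ z → x ≤ z
  ≤-trans x≤y y≤z = sym (Ord.trans (sym x≤y) (sym y≤z))

  ≤-antisym : ∀ {x y} → x ≤ y → y ≤ x → x ≈ y
  ≤-antisym x≤y y≤x = Ord.antisym (sym x≤y) (sym y≤x)

  ≤-respʳ-≈ : ∀ {x y z} → y ≈ z → x ≤ y → x ≤ z
  ≤-respʳ-≈ y≈z x≤y = ≤-trans x≤y (≤-reflexive y≈z)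

  ≤-respˡ-≈ : ∀ {x y z} → x ≈ y → x ≤ z → y ≤ z
  ≤-respˡ-≈ x≈y x≤z = ≤-trans (≤-reflexive (sym x≈y)) x≤z

  x∧y≤x : ∀ x y → x ∧ y ≤ x
  x∧y≤x x y = sym (Ord.x∧y≤x x y)

  x∧y≤y : ∀ x y → x ∧ y ≤ y
  x∧y≤y x y = sym (Ord.x∧y≤y x y)

  ∧-greatest : ∀ {x y z} → z ≤ x → z ≤ y → z ≤ x ∧ y
  ∧-greatest z≤x z≤y = sym (Ord.∧-greatest (sym z≤x) (sym z≤y))

  x≤x∨y : ∀ x y → x ≤ x ∨ y
  x≤x∨y x y = sym (Ord.x≤x∨y x y)

  y≤x∨y : ∀ x y → y ≤ x ∨ y
  y≤x∨y x y = sym (Ord.y≤x∨y x y)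

  ∨-least : ∀ {x y z} → x ≤ z → y ≤ z → x ∨ y ≤ z
  ∨-least x≤z y≤z = sym (Ord.∨-least (sym x≤z) (sym y≤z))

  ∨-monotonic : ∀ {x y z w} → x ≤ z → y ≤ w → x ∨ y ≤ z ∨ w
  ∨-monotonic x≤z y≤w = ∨-least (≤-trans x≤z (x≤x∨y _ _)) (≤-trans y≤w (y≤x∨y _ _))

  x≤y⇒x∨y≈y : ∀ {x y} → x ≤ y → x ∨ y ≈ y
  x≤y⇒x∨y≈y x≤y = ≤-antisym (∨-least x≤y ≤-refl) (y≤x∨y _ _)

  x≤y⇒y∨x≈y : ∀ {x y} → x ≤ y → y ∨ x ≈ y
  x≤y⇒y∨x≈y x≤y = trans (∨-comm _ _) (x≤y⇒x∨y≈y x≤y)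

  ∨-interchange : ∀ p q r s → (p ∨ q) ∨ (r ∨ s) ≈ (p ∨ r) ∨ (q ∨ s)
  ∨-interchange = CommutativeSemigroupProperties.interchange ∨-commutativeSemigroup
    where
    ∨-commutativeSemigroup : CommutativeSemigroup c ℓ
    ∨-commutativeSemigroup = record
      { isCommutativeSemigroup = IsCommutativeBand.isCommutativeSemigroup ∨-isSemilattice }

  x≤y′⇒y≤x′ : ∀ {x y} → x ≤ y ′ → y ≤ x ′
  x≤y′⇒y≤x′ x≤y′ = ≤-respˡ-≈ (′-invol _) (′-antitone x≤y′)

  x′≈y⇒y′≈x : ∀ {x y} → x ′ ≈ y → y ′ ≈ x
  x′≈y⇒y′≈x x′≈y = trans (′-cong (sym x′≈y)) (′-invol _)

  deMorgan₂ : ∀ x y → (x ∨ y) ′ ≈ x ′ ∧ y ′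
  deMorgan₂ x y = ≤-antisym
    (∧-greatest (′-antitone (x≤x∨y x y)) (′-antitone (y≤x∨y x y)))
    (x≤y′⇒y≤x′ (∨-least (x≤y′⇒y≤x′ (x∧y≤x (x ′) (y ′))) (x≤y′⇒y≤x′ (x∧y≤y (x ′) (y ′)))))

  deMorgan₁ : ∀ x y → (x ∧ y) ′ ≈ x ′ ∨ y ′
  deMorgan₁ x y = x′≈y⇒y′≈x (begin
    (x ′ ∨ y ′) ′ ≈⟨ deMorgan₂ (x ′) (y ′) ⟩
    x ′ ′ ∧ y ′ ′ ≈⟨ ∧-cong (′-invol x) (′-invol y) ⟩
    x ∧ y         ∎)

  Sharp : Carrier → Carrier → Set ℓ
  Sharp u z = z ∧ z ′ ≈ u

  Sharp-resp-≈ : ∀ {u z z₁} → z ≈ z₁ → Sharp u z → Sharp u z₁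
  Sharp-resp-≈ z≈z₁ sharp = trans (∧-cong (sym z≈z₁) (′-cong (sym z≈z₁))) sharp

  Sharp-′ : ∀ {u z} → Sharp u z → Sharp u (z ′)
  Sharp-′ {z = z} sharp = trans (∧-cong refl (′-invol z)) (trans (∧-comm _ _) sharp)

  Sharp⇒∨≈′ : ∀ {u z} → Sharp u z → z ∨ z ′ ≈ u ′
  Sharp⇒∨≈′ {u} {z} sharp = begin
    z ∨ z ′     ≈⟨ ∨-comm _ _ ⟩
    z ′ ∨ z     ≈⟨ ∨-congˡ (sym (′-invol z)) ⟩
    z ′ ∨ z ′ ′ ≈⟨ sym (deMorgan₁ z (z ′)) ⟩
    (z ∧ z ′) ′ ≈⟨ ′-cong sharp ⟩
    u ′         ∎

  SP2⇒Sharp : SP2 A → ∀ {x y} → x ≤ y → Sharp (0[_,_] A x y) (x ′ ∧ y)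
  SP2⇒Sharp sp2 x≤y = sym (sp2 _ _ x≤y)

  [x∧x′]′≈x∨x′ : ∀ x → (x ∧ x ′) ′ ≈ x ∨ x ′
  [x∧x′]′≈x∨x′ x = trans (deMorgan₁ x (x ′)) (trans (∨-congˡ (′-invol x)) (∨-comm _ _))

  0[x,y]′≈1[x,y] : ∀ x y → (0[_,_] A x y) ′ ≈ 1[_,_] A x y
  0[x,y]′≈1[x,y] x y = trans (deMorgan₂ _ _) (∧-cong ([x∧x′]′≈x∨x′ x) ([x∧x′]′≈x∨x′ y))

  0[x,y]≤1[x,y] : ∀ x y → 0[_,_] A x y ≤ 1[_,_] A x y
  0[x,y]≤1[x,y] x y = ∨-least (∧-greatest (kleene x x) (kleene x y)) (∧-greatest (kleene y x) (kleene y y))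

  π-≈ : ∀ {u} z → u ≤ u ′ → π A u z ≈ (z ∧ u ′) ∨ u
  π-≈ z u≤u′ = ∨-cong (∧-congˡ (x≤y⇒x∨y≈y u≤u′)) u≤u′

  orthomodular : SpOrthomodular A → ∀ {u a b} → u ≤ a → a ≤ b → b ≤ u ′ →
                 Sharp u a → Sharp u b → Sharp u (a ′ ∧ b) → b ≈ a ∨ (a ′ ∧ b)
  orthomodular (sp1 , sp2) {u} {a} {b} u≤a a≤b b≤u′ sharp-a sharp-b sharp-w = begin
    b             ≈⟨ sym b≤u′ ⟩
    b ∧ u ′       ≈⟨ ∧-congˡ (sym (Sharp⇒∨≈′ sharp-p)) ⟩
    b ∧ (p ∨ p ′) ≈⟨ sp1 p b p≤b p′∧b≈0[p,b] ⟩
    p ∨ (b ∧ b ′) ≈⟨ ∨-congˡ sharp-b ⟩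
    p ∨ u         ≈⟨ x≤y⇒y∨x≈y (≤-trans u≤a (x≤x∨y a w)) ⟩
    p             ∎
    where
    w p : Carrier
    w = a ′ ∧ b
    p = a ∨ w

    w′≈a∨b′ : w ′ ≈ a ∨ b ′
    w′≈a∨b′ = trans (deMorgan₁ (a ′) b) (∨-congʳ (′-invol a))

    p′≈a′∧w′ : p ′ ≈ a ′ ∧ (a ∨ b ′)
    p′≈a′∧w′ = trans (deMorgan₂ a w) (∧-congˡ w′≈a∨b′)

    -- p ′ is the element a ′ ∧ (a ∨ b ′) that SP2 makes sharp for a ≤ a ∨ b ′ = w ′.
    sharp-p : Sharp u p
    sharp-p = Sharp-resp-≈ (′-invol p) (Sharp-′ (Sharp-resp-≈ (sym p′≈a′∧w′)
      (trans (SP2⇒Sharp sp2 (x≤x∨y a (b ′)))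
        (trans (∨-cong sharp-a (Sharp-resp-≈ w′≈a∨b′ (Sharp-′ sharp-w))) (∨-idem u)))))

    p≤b : p ≤ b
    p≤b = ∨-least a≤b (x∧y≤y (a ′) b)

    p′∧b≈0[p,b] : p ′ ∧ b ≈ 0[_,_] A p b
    p′∧b≈0[p,b] = begin
      p ′ ∧ b         ≈⟨ ∧-congʳ (trans (deMorgan₂ a w) (∧-comm _ _)) ⟩
      (w ′ ∧ a ′) ∧ b ≈⟨ ∧-assoc _ _ _ ⟩
      w ′ ∧ w         ≈⟨ ∧-comm _ _ ⟩
      w ∧ w ′         ≈⟨ sharp-w ⟩
      u               ≈⟨ sym (∨-idem u) ⟩
      u ∨ u           ≈⟨ sym (∨-cong sharp-p sharp-b) ⟩
      0[_,_] A p b    ∎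

  module Partition {u p₁ p₂ p₃ : Carrier}
    (u≤p₁ : u ≤ p₁) (u≤p₂ : u ≤ p₂) (u≤p₃ : u ≤ p₃)
    (p₁′≈ : p₁ ′ ≈ p₂ ∨ p₃) (p₂′≈ : p₂ ′ ≈ p₁ ∨ p₃) (p₃′≈ : p₃ ′ ≈ p₁ ∨ p₂)
    (u′≈ : u ′ ≈ p₁ ∨ (p₂ ∨ p₃)) where

    block : Bool → Carrier → Carrier
    block s p = if s then p else u

    embed : Bool³ → Carrier
    embed (s₁ , s₂ , s₃) = block s₁ p₁ ∨ (block s₂ p₂ ∨ block s₃ p₃)

    block-or : ∀ s t {p} → u ≤ p → block (s or t) p ≈ block s p ∨ block t p
    block-or false false u≤p = sym (∨-idem u)
    block-or false true  u≤p = sym (x≤y⇒x∨y≈y u≤p)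
    block-or true  false u≤p = sym (x≤y⇒y∨x≈y u≤p)
    block-or true  true  {p} u≤p = sym (∨-idem p)

    embed-∨ : ∀ p q → embed (p ∨³ q) ≈ embed p ∨ embed q
    embed-∨ (s₁ , s₂ , s₃) (t₁ , t₂ , t₃) = begin
      embed ((s₁ , s₂ , s₃) ∨³ (t₁ , t₂ , t₃))
        ≈⟨ ∨-cong (block-or s₁ t₁ u≤p₁) (∨-cong (block-or s₂ t₂ u≤p₂) (block-or s₃ t₃ u≤p₃)) ⟩
      (block s₁ p₁ ∨ block t₁ p₁) ∨ ((block s₂ p₂ ∨ block t₂ p₂) ∨ (block s₃ p₃ ∨ block t₃ p₃))
        ≈⟨ ∨-congˡ (∨-interchange _ _ _ _) ⟩
      (block s₁ p₁ ∨ block t₁ p₁) ∨ ((block s₂ p₂ ∨ block s₃ p₃) ∨ (block t₂ p₂ ∨ block t₃ p₃))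
        ≈⟨ ∨-interchange _ _ _ _ ⟩
      embed (s₁ , s₂ , s₃) ∨ embed (t₁ , t₂ , t₃) ∎

    embed-false³ : embed false³ ≈ u
    embed-false³ = trans (∨-congˡ (∨-idem u)) (∨-idem u)

    embed₁ : embed (true , false , false) ≈ p₁
    embed₁ = trans (∨-congˡ (∨-idem u)) (x≤y⇒y∨x≈y u≤p₁)

    embed₂ : embed (false , true , false) ≈ p₂
    embed₂ = trans (∨-congˡ (x≤y⇒y∨x≈y u≤p₂)) (x≤y⇒x∨y≈y u≤p₂)

    embed₃ : embed (false , false , true) ≈ p₃
    embed₃ = trans (∨-congˡ (x≤y⇒x∨y≈y u≤p₃)) (x≤y⇒x∨y≈y u≤p₃)

    embed₁₂ : embed (true , true , false) ≈ p₁ ∨ p₂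
    embed₁₂ = ∨-congˡ (x≤y⇒y∨x≈y u≤p₂)

    embed₁₃ : embed (true , false , true) ≈ p₁ ∨ p₃
    embed₁₃ = ∨-congˡ (x≤y⇒x∨y≈y u≤p₃)

    embed₂₃ : embed (false , true , true) ≈ p₂ ∨ p₃
    embed₂₃ = x≤y⇒x∨y≈y (≤-trans u≤p₂ (x≤x∨y p₂ p₃))

    embed-′ : ∀ p → embed p ′ ≈ embed (not³ p)
    embed-′ (false , false , false) = trans (′-cong embed-false³) u′≈
    embed-′ (true  , false , false) = trans (′-cong embed₁) (trans p₁′≈ (sym embed₂₃))
    embed-′ (false , true  , false) = trans (′-cong embed₂) (trans p₂′≈ (sym embed₁₃))
    embed-′ (false , false , true ) = trans (′-cong embed₃) (trans p₃′≈ (sym embed₁₂))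
    embed-′ (true  , true  , true ) = x′≈y⇒y′≈x (embed-′ false³)
    embed-′ (false , true  , true ) = x′≈y⇒y′≈x (embed-′ (true , false , false))
    embed-′ (true  , false , true ) = x′≈y⇒y′≈x (embed-′ (false , true , false))
    embed-′ (true  , true  , false) = x′≈y⇒y′≈x (embed-′ (false , false , true))

    embed-∧ : ∀ p q → embed p ∧ embed q ≈ embed (p ∧³ q)
    embed-∧ p q = begin
      embed p ∧ embed q                   ≈⟨ sym (′-invol _) ⟩
      (embed p ∧ embed q) ′ ′             ≈⟨ ′-cong (deMorgan₁ (embed p) (embed q)) ⟩
      (embed p ′ ∨ embed q ′) ′           ≈⟨ ′-cong (∨-cong (embed-′ p) (embed-′ q)) ⟩
      (embed (not³ p) ∨ embed (not³ q)) ′ ≈⟨ ′-cong (sym (embed-∨ (not³ p) (not³ q))) ⟩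
      embed (not³ p ∨³ not³ q) ′          ≈⟨ embed-′ (not³ p ∨³ not³ q) ⟩
      embed (not³ (not³ p ∨³ not³ q))     ≈⟨ reflexive (cong embed (not³-deMorgan p q)) ⟩
      embed (p ∧³ q)                      ∎

    u≤embed : ∀ p → u ≤ embed p
    u≤embed (true  , _ , _) = ≤-trans u≤p₁ (x≤x∨y _ _)
    u≤embed (false , _ , _) = x≤x∨y _ _

    embed≤u′ : ∀ p → embed p ≤ u ′
    embed≤u′ p = x≤y′⇒y≤x′ (≤-respʳ-≈ (sym (embed-′ p)) (u≤embed (not³ p)))

    InImage : Carrier → Set ℓ
    InImage z = Σ[ p ∈ Bool³ ] z ≈ embed p

    module _ {x y a b : Carrier} (0≈u : 0[_,_] A x y ≈ u) (1≈u′ : 1[_,_] A x y ≈ u ′)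
             (a∈image : InImage a) (b∈image : InImage b) where

      generated⊆image : ∀ {z} → Generated A x y a b z → InImage z
      generated⊆image gen-a = a∈image
      generated⊆image gen-b = b∈image
      generated⊆image gen-0 = false³ , trans 0≈u (sym embed-false³)
      generated⊆image gen-1 = true³ , trans 1≈u′ u′≈
      generated⊆image (gen-∧ g h) with generated⊆image g | generated⊆image h
      ... | p , z≈ | q , w≈ = p ∧³ q , trans (∧-cong z≈ w≈) (embed-∧ p q)
      generated⊆image (gen-∨ g h) with generated⊆image g | generated⊆image h
      ... | p , z≈ | q , w≈ = p ∨³ q , trans (∨-cong z≈ w≈) (sym (embed-∨ p q))
      generated⊆image (gen-′ g) with generated⊆image g
      ... | p , z≈ = not³ p , trans (′-cong z≈) (embed-′ p)

      generates-Boolean : GenerateBooleanSubalgebra A x y a b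
      generates-Boolean = record
        { inInterval = in-interval
        ; has-0      = gen-0
        ; has-1      = gen-1
        ; ∧-closed   = gen-∧
        ; ∨-closed   = gen-∨
        ; ′-closed   = gen-′
        ; distrib    = distributive
        ; complement = complemented
        }
        where
        in-interval : ∀ {z} → Generated A x y a b z → (0[_,_] A x y ≤ z) × (z ≤ 1[_,_] A x y)
        in-interval g with generated⊆image g
        ... | p , z≈ = ≤-respʳ-≈ (sym z≈) (≤-respˡ-≈ (sym 0≈u) (u≤embed p))
                     , ≤-respˡ-≈ (sym z≈) (≤-respʳ-≈ (sym 1≈u′) (embed≤u′ p))

        distributive : ∀ {z w v} → Generated A x y a b z → Generated A x y a b w →
                       Generated A x y a b v → z ∧ (w ∨ v) ≈ (z ∧ w) ∨ (z ∧ v)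
        distributive gz gw gv with generated⊆image gz | generated⊆image gw | generated⊆image gv
        ... | p , z≈ | q , w≈ | r , v≈ = begin
          _                               ≈⟨ ∧-cong z≈ (trans (∨-cong w≈ v≈) (sym (embed-∨ q r))) ⟩
          embed p ∧ embed (q ∨³ r)        ≈⟨ embed-∧ p (q ∨³ r) ⟩
          embed (p ∧³ (q ∨³ r))           ≈⟨ reflexive (cong embed (∧³-distribˡ-∨³ p q r)) ⟩
          embed (p ∧³ q ∨³ p ∧³ r)        ≈⟨ embed-∨ (p ∧³ q) (p ∧³ r) ⟩
          embed (p ∧³ q) ∨ embed (p ∧³ r) ≈⟨ sym (∨-cong (trans (∧-cong z≈ w≈) (embed-∧ p q))
                                                         (trans (∧-cong z≈ v≈) (embed-∧ p r))) ⟩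
          _                               ∎

        complemented : ∀ {z} → Generated A x y a b z → z ∧ z ′ ≈ 0[_,_] A x y
        complemented g with generated⊆image g
        ... | p , z≈ = begin
          _                        ≈⟨ ∧-cong z≈ (trans (′-cong z≈) (embed-′ p)) ⟩
          embed p ∧ embed (not³ p) ≈⟨ embed-∧ p (not³ p) ⟩
          embed (p ∧³ not³ p)      ≈⟨ reflexive (cong embed (∧³-inverseʳ p)) ⟩
          embed false³             ≈⟨ embed-false³ ⟩
          u                        ≈⟨ sym 0≈u ⟩
          _                        ∎

  module Local {x y : Carrier} (x≤y : x ≤ y) where
    n m u a b w : Carrier
    n = x ∧ x ′
    m = y ∧ y ′
    u = 0[_,_] A x y
    a = π A u x
    b = π A u y
    w = a ′ ∧ b

    u′≈n′∧m′ : u ′ ≈ n ′ ∧ m ′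
    u′≈n′∧m′ = deMorgan₂ n m

    n≤x : n ≤ x
    n≤x = x∧y≤x x (x ′)

    x≤n′ : x ≤ n ′
    x≤n′ = ≤-respʳ-≈ (sym ([x∧x′]′≈x∨x′ x)) (x≤x∨y x (x ′))

    x′≤n′ : x ′ ≤ n ′
    x′≤n′ = ≤-respʳ-≈ (sym ([x∧x′]′≈x∨x′ x)) (y≤x∨y x (x ′))

    y≤m′ : y ≤ m ′
    y≤m′ = ≤-respʳ-≈ (sym ([x∧x′]′≈x∨x′ y)) (x≤x∨y y (y ′))

    m≤m′ : m ≤ m ′
    m≤m′ = ≤-respʳ-≈ (sym ([x∧x′]′≈x∨x′ y)) (kleene y y)

    u≤u′ : u ≤ u ′
    u≤u′ = ≤-respʳ-≈ (sym (0[x,y]′≈1[x,y] x y)) (0[x,y]≤1[x,y] x y)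

    x≤u′ : x ≤ u ′
    x≤u′ = ≤-respʳ-≈ (sym u′≈n′∧m′) (∧-greatest x≤n′ (≤-trans x≤y y≤m′))

    a≈x∨m : a ≈ x ∨ m
    a≈x∨m = begin
      a             ≈⟨ π-≈ x u≤u′ ⟩
      (x ∧ u ′) ∨ u ≈⟨ ∨-congʳ x≤u′ ⟩
      x ∨ (n ∨ m)   ≈⟨ sym (∨-assoc x n m) ⟩
      (x ∨ n) ∨ m   ≈⟨ ∨-congʳ (x≤y⇒y∨x≈y n≤x) ⟩
      x ∨ m         ∎

    a′≈x′∧m′ : a ′ ≈ x ′ ∧ m ′
    a′≈x′∧m′ = trans (′-cong a≈x∨m) (deMorgan₂ x m)

    n′∧y≤u′ : n ′ ∧ y ≤ u ′
    n′∧y≤u′ = ≤-respʳ-≈ (sym u′≈n′∧m′) (∧-greatest (x∧y≤x _ _) (≤-trans (x∧y≤y _ _) y≤m′))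

    u≤n′∧y : u ≤ n ′ ∧ y
    u≤n′∧y = ∨-least (∧-greatest (≤-trans n≤x x≤n′) (≤-trans n≤x x≤y))
                     (∧-greatest (≤-trans (x∧y≤y y (y ′)) (≤-trans (′-antitone x≤y) x′≤n′))
                                 (x∧y≤x y (y ′)))

    b≈n′∧y : b ≈ n ′ ∧ y
    b≈n′∧y = trans (π-≈ y u≤u′) (≤-antisym
      (∨-least (∧-greatest (≤-trans (x∧y≤y y (u ′)) (≤-respˡ-≈ (sym u′≈n′∧m′) (x∧y≤x _ _)))
                           (x∧y≤x y (u ′)))
               u≤n′∧y)
      (≤-trans (∧-greatest (x∧y≤y _ _) n′∧y≤u′) (x≤x∨y _ _)))

    w≈x′∧y : w ≈ x ′ ∧ y
    w≈x′∧y = trans (∧-cong a′≈x′∧m′ b≈n′∧y) (≤-antisym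
      (∧-greatest (≤-trans (x∧y≤x _ _) (x∧y≤x _ _)) (≤-trans (x∧y≤y _ _) (x∧y≤y _ _)))
      (∧-greatest (∧-greatest (x∧y≤x _ _) (≤-trans (x∧y≤y _ _) y≤m′))
                  (∧-greatest (≤-trans (x∧y≤x _ _) x′≤n′) (x∧y≤y _ _))))

    u≤a : u ≤ a
    u≤a = ≤-respʳ-≈ (sym a≈x∨m) (∨-monotonic n≤x ≤-refl)

    a≤b : a ≤ b
    a≤b = ≤-respˡ-≈ (sym a≈x∨m) (≤-respʳ-≈ (sym b≈n′∧y)
            (∨-least (∧-greatest x≤n′ x≤y) (≤-trans (y≤x∨y n m) u≤n′∧y)))

    b≤u′ : b ≤ u ′
    b≤u′ = ≤-respˡ-≈ (sym b≈n′∧y) n′∧y≤u′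

    u≤w : u ≤ w
    u≤w = ∧-greatest (x≤y′⇒y≤x′ (≤-trans a≤b b≤u′)) (≤-trans u≤a a≤b)

    u≤b′ : u ≤ b ′
    u≤b′ = x≤y′⇒y≤x′ b≤u′

    w′≈a∨b′ : w ′ ≈ a ∨ b ′
    w′≈a∨b′ = trans (deMorgan₁ (a ′) b) (∨-congʳ (′-invol a))

    module _ (sp : SpOrthomodular A) where
      private
        sp2 : SP2 A
        sp2 = proj₂ sp

      -- a ′ = x ′ ∧ m ′ and b = n ′ ∧ y are the SP2 elements of x ≤ m ′ and n ≤ y,
      -- whose local bottoms equal u because m ≤ m ′ and n ≤ n ′.
      sharp-a : Sharp u a
      sharp-a = Sharp-resp-≈ (′-invol a) (Sharp-′ (Sharp-resp-≈ (sym a′≈x′∧m′)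
        (trans (SP2⇒Sharp sp2 (≤-trans x≤y y≤m′))
               (∨-congˡ (trans (∧-congˡ (′-invol m)) (trans (∧-comm _ _) m≤m′))))))

      sharp-b : Sharp u b
      sharp-b = Sharp-resp-≈ (sym b≈n′∧y)
        (trans (SP2⇒Sharp sp2 (≤-trans n≤x x≤y)) (∨-congʳ (≤-trans n≤x x≤n′)))

      sharp-w : Sharp u w
      sharp-w = Sharp-resp-≈ (sym w≈x′∧y) (SP2⇒Sharp sp2 x≤y)

      b≈a∨w : b ≈ a ∨ w
      b≈a∨w = orthomodular sp u≤a a≤b b≤u′ sharp-a sharp-b sharp-w

      a′≈w∨b′ : a ′ ≈ w ∨ b ′
      a′≈w∨b′ = trans
        (orthomodular sp u≤b′ (′-antitone a≤b) (′-antitone u≤a)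
                      (Sharp-′ sharp-b) (Sharp-′ sharp-a) (Sharp-resp-≈ (sym b″∧a′≈w) sharp-w))
        (trans (∨-congˡ b″∧a′≈w) (∨-comm _ _))
        where
        b″∧a′≈w : b ′ ′ ∧ a ′ ≈ w
        b″∧a′≈w = trans (∧-congʳ (′-invol b)) (∧-comm _ _)

      u′≈a∨w∨b′ : u ′ ≈ a ∨ (w ∨ b ′)
      u′≈a∨w∨b′ = trans (sym (Sharp⇒∨≈′ sharp-b)) (trans (∨-congʳ b≈a∨w) (∨-assoc a w (b ′)))

      open Partition u≤a u≤w u≤b′ a′≈w∨b′ w′≈a∨b′ (trans (′-invol b) b≈a∨w) u′≈a∨w∨b′

      π-generates-Boolean : GenerateBooleanSubalgebra A x y a b
      π-generates-Boolean = generates-Boolean refl (sym (0[x,y]′≈1[x,y] x y))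
        ((true , false , false) , sym embed₁) ((true , true , false) , trans b≈a∨w (sym embed₁₂))

    module _ (boolean : GenerateBooleanSubalgebra A x y a b) where
      open IsBooleanSubalgebraOfLocal boolean

      SP2-instance : u ≈ (x ′ ∧ y) ∧ (x ′ ∧ y) ′
      SP2-instance = sym (Sharp-resp-≈ w≈x′∧y (complement (gen-∧ (gen-′ gen-a) gen-b)))

      SP1-instance : x ′ ∧ y ≈ u → y ∧ (x ∨ x ′) ≈ x ∨ m
      SP1-instance x′∧y≈u = begin
        y ∧ (x ∨ x ′)       ≈⟨ trans (∧-comm _ _) (∧-congʳ (sym ([x∧x′]′≈x∨x′ x))) ⟩
        n ′ ∧ y             ≈⟨ sym b≈n′∧y ⟩
        b                   ≈⟨ sym b≤u′ ⟩
        b ∧ u ′             ≈⟨ ∧-congˡ (sym (Sharp⇒∨≈′ (complement gen-a))) ⟩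
        b ∧ (a ∨ a ′)       ≈⟨ distrib gen-b gen-a (gen-′ gen-a) ⟩
        (b ∧ a) ∨ (b ∧ a ′) ≈⟨ ∨-cong (trans (∧-comm _ _) a≤b)
                                       (trans (∧-comm _ _) (trans w≈x′∧y x′∧y≈u)) ⟩
        a ∨ u               ≈⟨ x≤y⇒y∨x≈y u≤a ⟩
        a                   ≈⟨ a≈x∨m ⟩
        x ∨ m               ∎

  SpOrthomodular⇒Boolean : SpOrthomodular A →
    ∀ x y → x ≤ y → GenerateBooleanSubalgebra A x y (π A (0[_,_] A x y) x) (π A (0[_,_] A x y) y)
  SpOrthomodular⇒Boolean sp x y x≤y = Local.π-generates-Boolean x≤y sp

  Boolean⇒SpOrthomodular :
    (∀ x y → x ≤ y → GenerateBooleanSubalgebra A x y (π A (0[_,_] A x y) x) (π A (0[_,_] A x y) y)) →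
    SpOrthomodular A
  Boolean⇒SpOrthomodular boolean =
    (λ x y x≤y → Local.SP1-instance x≤y (boolean x y x≤y)) ,
    (λ x y x≤y → Local.SP2-instance x≤y (boolean x y x≤y))

lemma4p8 : ∀ {c ℓ : Level} (A : PseudoKleeneLattice c ℓ) →
    SpOrthomodular A ⇔
      (∀ x y → PseudoKleeneLattice._≤_ A x y →
        GenerateBooleanSubalgebra A x y (π A (0[_,_] A x y) x) (π A (0[_,_] A x y) y))
lemma4p8 A = mk⇔ (SpOrthomodular⇒Boolean A) (Boolean⇒SpOrthomodular A)
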